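{- Let $(B,\sqsubseteq)$ be a bounded complete predomain base on which $\ll$ is decidable. Then $B$ has the weak interpolation property: whenever $x\ll z$ for $x,z\in B$, there weakly exists $y\in B$ such that $x\ll y\ll z$.
   Context: Work constructively; "there weakly exists $y$ such that $A$" means $\neg\forall y.\neg A$. In a poset, a chain is a sequence $(x_n)$ with $x_n\sqsubseteq x_{n+1}$; $b\ll c$ means: for every chain $(x_n)$ in $B$ whose supremum exists in $B$ and satisfies $c\sqsubseteq\bigsqcup_n x_n$, there weakly exists $n$ with $b\sqsubseteq x_n$. An approximating sequence of $b$ is a chain $(b_n)$ with $b_n\ll b$ for all $n$ and $\bigsqcup_n b_n=b$. A predomain base is a countable poset $B=\{b_n\mid n\in\mathbb N\}$ with decidable order in which every element has an approximating sequence. A nonempty finite subset is consistent if there weakly exists an upper bound of it; $B$ is bounded complete if every finite consistent subset has a least upper bound. -}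

module Defs where

open import Data.Nat using (ℕ; suc)
open import Data.Product using (Σ; _×_; _,_)
open import Data.List.NonEmpty using (List⁺)
open import Data.List.NonEmpty.Relation.Unary.All using (All)
open import Relation.Nullary using (¬_; Dec)
open import Relation.Binary.PropositionalEquality using (_≡_)

-- "there weakly exists x such that P x" := ¬ ∀ x. ¬ P x
WeakEx : {A : Set} → (A → Set) → Set
WeakEx {A} P = ¬ ((x : A) → ¬ P x)

record CountableDecPoset : Set₁ where
  field
    Carrier   : Set
    _⊑_       : Carrier → Carrier → Set
    refl⊑     : ∀ x → x ⊑ x
    trans⊑    : ∀ {x y z} → x ⊑ y → y ⊑ z → x ⊑ z
    antisym⊑  : ∀ {x y} → x ⊑ y → y ⊑ x → x ≡ y
    _⊑?_      : ∀ x y → Dec (x ⊑ y)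
    enum      : ℕ → Carrier
    enum-surj : ∀ b → Σ ℕ (λ n → enum n ≡ b)

module _ (B : CountableDecPoset) where
  open CountableDecPoset B

  IsChain : (ℕ → Carrier) → Set
  IsChain x = ∀ n → x n ⊑ x (suc n)

  IsSup : (ℕ → Carrier) → Carrier → Set
  IsSup x s = (∀ n → x n ⊑ s) × (∀ u → (∀ n → x n ⊑ u) → s ⊑ u)

  _≪_ : Carrier → Carrier → Set
  b ≪ c = (x : ℕ → Carrier) → IsChain x → (s : Carrier) → IsSup x s →
          c ⊑ s → WeakEx (λ n → b ⊑ x n)

  IsApproxSeq : Carrier → (ℕ → Carrier) → Set
  IsApproxSeq b x = IsChain x × (∀ n → x n ≪ b) × IsSup x b

  UpperBound : List⁺ Carrier → Carrier → Set
  UpperBound F u = All (λ a → a ⊑ u) F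

  IsLUB : List⁺ Carrier → Carrier → Set
  IsLUB F s = UpperBound F s × (∀ u → UpperBound F u → s ⊑ u)

  Consistent : List⁺ Carrier → Set
  Consistent F = WeakEx (UpperBound F)

  BoundedComplete : Set
  BoundedComplete = (F : List⁺ Carrier) → Consistent F → Σ Carrier (IsLUB F)

  WeakInterpolation : Set
  WeakInterpolation = ∀ x z → x ≪ z → WeakEx (λ y → (x ≪ y) × (y ≪ z))

record PredomainBase : Set₁ where
  field
    poset  : CountableDecPoset
  open CountableDecPoset poset public
  field
    approx    : Carrier → ℕ → Carrier
    approx-ok : ∀ b → IsApproxSeq poset b (approx b)

module Submission where

-- Let x ≪ z, let (zₙ) approximate z and, for each n, let (aₙᵏ)ₖ approximate zₙ.
-- All aᵢᵏ lie below z, so by bounded completeness the finite joins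
--   dₖ = ⋁ { aᵢᵏ ∣ i ≤ k }
-- exist.  They form a chain (aᵢᵏ ⊑ aᵢᵏ⁺¹) whose supremum is z (every aₙᵏ lies
-- below d_{k+n}), and dₖ ≪ zₖ because each aᵢᵏ ≪ zᵢ ⊑ zₖ and a finite join of
-- elements way below c is way below c.  Applying x ≪ z to the chain (dₖ), there
-- weakly is a k with x ⊑ dₖ, hence x ≪ zₖ ≪ z, so y = zₖ interpolates.

open import Defs
open import Relation.Nullary using (Dec)
open import Data.Nat using (ℕ; zero; suc; _+_; _≤_; _≤′_; ≤′-refl; ≤′-step; z≤n; s≤s; _⊔_)
open import Data.Nat.Properties
  using (≤⇒≤′; ≤-refl; ≤-trans; n≤1+n; m≤n+m; m≤m+n; m≤n⇒m<n∨m≡n; m≤m⊔n; m≤n⊔m)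
open import Data.Product using (Σ; _×_; _,_; proj₁; proj₂)
open import Data.Sum using (inj₁; inj₂)
open import Data.List using ([]; _∷_)
open import Data.List.NonEmpty using (_∷_)
open import Data.List.NonEmpty.Relation.Unary.All using (_∷_)
import Data.List.Relation.Unary.All as List
open import Relation.Binary.PropositionalEquality using (refl)

module _ (P : CountableDecPoset) where
  open CountableDecPoset P

  chain-mono : ∀ {x} → IsChain P x → ∀ {m n} → m ≤ n → x m ⊑ x n
  chain-mono {x} chain m≤n = go (≤⇒≤′ m≤n)
    where
    go : ∀ {m n} → m ≤′ n → x m ⊑ x n
    go ≤′-refl         = refl⊑ _
    go (≤′-step m≤′n) = trans⊑ (go m≤′n) (chain _)

  ⊑-≪ : ∀ {a b c} → a ⊑ b → _≪_ P b c → _≪_ P a c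
  ⊑-≪ a⊑b b≪c x chain s sup c⊑s no-index =
    b≪c x chain s sup c⊑s (λ n b⊑xn → no-index n (trans⊑ a⊑b b⊑xn))

  ≪-⊑ : ∀ {a b c} → _≪_ P a b → b ⊑ c → _≪_ P a c
  ≪-⊑ a≪b b⊑c x chain s sup c⊑s = a≪b x chain s sup (trans⊑ b⊑c c⊑s)

  bound-suc : ∀ (f : ℕ → Carrier) n {u} → (∀ i → i ≤ n → f i ⊑ u) → f (suc n) ⊑ u →
    ∀ i → i ≤ suc n → f i ⊑ u
  bound-suc f n f⊑u fsn⊑u i i≤sn with m≤n⇒m<n∨m≡n i≤sn
  ... | inj₁ (s≤s i≤n) = f⊑u i i≤n
  ... | inj₂ refl      = fsn⊑u

  common-index : ∀ {x} → IsChain P x → (f : ℕ → Carrier) → ∀ n →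
    (∀ i → i ≤ n → WeakEx (λ m → f i ⊑ x m)) →
    WeakEx (λ m → ∀ i → i ≤ n → f i ⊑ x m)
  common-index chain f zero below no-index =
    below 0 z≤n (λ m f0⊑xm → no-index m (λ { .zero z≤n → f0⊑xm }))
  common-index chain f (suc n) below no-index =
    common-index chain f n (λ i i≤n → below i (≤-trans i≤n (n≤1+n n)))
      (λ m all⊑xm → below (suc n) ≤-refl (λ m′ fsn⊑xm′ →
        no-index (m ⊔ m′) (bound-suc f n
          (λ i i≤n → trans⊑ (all⊑xm i i≤n) (chain-mono chain (m≤m⊔n m m′)))
          (trans⊑ fsn⊑xm′ (chain-mono chain (m≤n⊔m m m′))))))

  FiniteLUB : (ℕ → Carrier) → ℕ → Carrier → Set
  FiniteLUB f n s = (∀ i → i ≤ n → f i ⊑ s) × (∀ u → (∀ i → i ≤ n → f i ⊑ u) → s ⊑ u)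

  finite-lub-≪ : ∀ (f : ℕ → Carrier) n {s c} → FiniteLUB f n s →
    (∀ i → i ≤ n → _≪_ P (f i) c) → _≪_ P s c
  finite-lub-≪ f n (_ , least) f≪c x chain t sup c⊑t no-index =
    common-index chain f n (λ i i≤n → f≪c i i≤n x chain t sup c⊑t)
      (λ m all⊑xm → no-index m (least (x m) all⊑xm))

  module _ (bounded-complete : BoundedComplete P) where

    binary-lub : ∀ {a b z} → a ⊑ z → b ⊑ z → Σ Carrier (IsLUB P (a ∷ b ∷ []))
    binary-lub {z = z} a⊑z b⊑z =
      bounded-complete _ (λ no-bound → no-bound z (a⊑z ∷ b⊑z List.∷ List.[]))

    finite-lub : ∀ (f : ℕ → Carrier) {z} → (∀ i → f i ⊑ z) → ∀ n → Σ Carrier (FiniteLUB f n)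
    finite-lub f f⊑z zero = f 0 , (λ { .zero z≤n → refl⊑ _ }) , (λ u f⊑u → f⊑u 0 z≤n)
    finite-lub f {z} f⊑z (suc n) with finite-lub f f⊑z n
    ... | s , s-upper , s-least with binary-lub (s-least z (λ i _ → f⊑z i)) (f⊑z (suc n))
    ... | j , (s⊑j ∷ fsn⊑j List.∷ List.[]) , j-least =
      j , bound-suc f n (λ i i≤n → trans⊑ (s-upper i i≤n) s⊑j) fsn⊑j , least
      where
      least : ∀ u → (∀ i → i ≤ suc n → f i ⊑ u) → j ⊑ u
      least u f⊑u = j-least u (s-least u (λ i i≤n → f⊑u i (≤-trans i≤n (n≤1+n n)))
                                ∷ f⊑u (suc n) ≤-refl List.∷ List.[])

module _ (B : PredomainBase) where
  open PredomainBase B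

  approx-chain : ∀ b → IsChain poset (approx b)
  approx-chain b = proj₁ (approx-ok b)

  approx-≪ : ∀ b n → _≪_ poset (approx b n) b
  approx-≪ b = proj₁ (proj₂ (approx-ok b))

  approx-upper : ∀ b n → approx b n ⊑ b
  approx-upper b = proj₁ (proj₂ (proj₂ (approx-ok b)))

  approx-least : ∀ b u → (∀ n → approx b n ⊑ u) → b ⊑ u
  approx-least b = proj₂ (proj₂ (proj₂ (approx-ok b)))

  module _ (bounded-complete : BoundedComplete poset) where

    -- Every z is the supremum of a chain (dₖ) with dₖ ≪ zₖ, where (zₖ) is the
    -- approximating sequence of z: take dₖ = ⋁ { aᵢᵏ ∣ i ≤ k } with (aᵢᵏ)ₖ the
    -- approximating sequence of zᵢ.
    diagonal-chain : ∀ z → Σ (ℕ → Carrier) λ d →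
      IsChain poset d × IsSup poset d z × (∀ k → _≪_ poset (d k) (approx z k))
    diagonal-chain z = d , d-chain , (d-upper , d-least) , d≪zs
      where
      zs : ℕ → Carrier
      zs = approx z

      a : ℕ → ℕ → Carrier
      a i = approx (zs i)

      a⊑z : ∀ k i → a i k ⊑ z
      a⊑z k i = trans⊑ (approx-upper (zs i) k) (approx-upper z i)

      d-lub : ∀ k → Σ Carrier (FiniteLUB poset (λ i → a i k) k)
      d-lub k = finite-lub poset bounded-complete (λ i → a i k) (a⊑z k) k

      d : ℕ → Carrier
      d k = proj₁ (d-lub k)

      d-above : ∀ {i k} → i ≤ k → a i k ⊑ d k
      d-above {i} {k} = proj₁ (proj₂ (d-lub k)) i

      d-below : ∀ k u → (∀ i → i ≤ k → a i k ⊑ u) → d k ⊑ u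
      d-below k = proj₂ (proj₂ (d-lub k))

      -- aᵢᵏ ⊑ aᵢᵏ⁺¹ ⊑ dₖ₊₁ for every i ≤ k.
      d-chain : IsChain poset d
      d-chain k = d-below k (d (suc k)) (λ i i≤k →
        trans⊑ (approx-chain (zs i) k) (d-above (≤-trans i≤k (n≤1+n k))))

      d-upper : ∀ k → d k ⊑ z
      d-upper k = d-below k z (λ i _ → a⊑z k i)

      -- An upper bound u of (dₖ) bounds each aₙᵏ ⊑ aₙᵏ⁺ⁿ ⊑ dₖ₊ₙ, hence each zₙ and z.
      d-least : ∀ u → (∀ k → d k ⊑ u) → z ⊑ u
      d-least u d⊑u = approx-least z u (λ n → approx-least (zs n) u (λ k →
        trans⊑ (chain-mono poset (approx-chain (zs n)) (m≤m+n k n))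
          (trans⊑ (d-above (m≤n+m n k)) (d⊑u (k + n)))))

      -- aᵢᵏ ≪ zᵢ ⊑ zₖ for i ≤ k.
      d≪zs : ∀ k → _≪_ poset (d k) (zs k)
      d≪zs k = finite-lub-≪ poset (λ i → a i k) k (proj₂ (d-lub k)) (λ i i≤k →
        ≪-⊑ poset (approx-≪ (zs i) k) (chain-mono poset (approx-chain z) i≤k))

proposition2p13 : (B : PredomainBase) → BoundedComplete (PredomainBase.poset B) →
    (∀ b c → Dec (_≪_ (PredomainBase.poset B) b c)) →
    WeakInterpolation (PredomainBase.poset B)
proposition2p13 B bounded-complete _ x z x≪z no-interpolant
  with diagonal-chain B bounded-complete z
... | d , d-chain , d-sup , d≪zs =
  -- x ≪ z = ⨆ d, so weakly x ⊑ dₖ ≪ zₖ for some k, and zₖ ≪ z.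
  x≪z d d-chain z d-sup (refl⊑ z) (λ k x⊑dk →
    no-interpolant (approx z k) (⊑-≪ poset x⊑dk (d≪zs k) , approx-≪ B z k))
  where open PredomainBase B
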